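{- If $C$ is a non-empty, globally coherent set of connector-types over a relational signature $\sigma$, then there exists a non-empty, globally coherent subset $D\subseteq C$ with $|D|\le 2^{|\sigma|}$.
   Context: $\sigma$ is purely relational (no constants, functions, equality, or proposition letters). A fluted $k$-literal is $\pm p(x_\ell,\ldots,x_k)$ with $p\in\sigma$ of arity $k-\ell+1$, $1\le\ell\le k$; a fluted $k$-type over $\sigma$ is a maximal consistent set of fluted $k$-literals over $\sigma$. For a 2-type $\tau$, $\tau_\uparrow$ removes literals containing $x_1$ and decrements indices. A connector-type over $\sigma$ is $\langle\pi,I,O\rangle$ with $\pi$ a 1-type, $I$ a set of fluted 2-types $\tau$ with $\tau_\uparrow=\pi$, $O$ a set of fluted 2-types (its inputs and outputs). A set $C$ of connector-types is globally coherent if (GC$\exists$) for all $\langle\pi,I,O\rangle\in C$ and all $\tau\in O$ there is $\langle\pi',I',O'\rangle\in C$ with $\tau\in I'$; and (GC$\forall$) for all $\langle\pi,I,O\rangle,\langle\pi',I',O'\rangle\in C$, $O\cap I'\ne\emptyset$. -}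

module Defs where

open import Data.Nat using (ℕ; _≤_; _≡ᵇ_)
open import Data.Bool using (Bool; false; if_then_else_)
open import Data.Fin using (Fin)
open import Data.Vec using (Vec; lookup; tabulate)
open import Data.List using (List)
open import Data.List.Relation.Unary.All using (All)
open import Data.List.Membership.Propositional using (_∈_)
open import Data.Product using (Σ; _×_; ∃-syntax)
open import Relation.Binary.PropositionalEquality using (_≡_; _≢_)

-- A purely relational signature: n predicate symbols p_0 … p_{n-1}, each with an
-- arity ≥ 1 (no proposition letters). |σ| = n.
record Sig : Set where
  field
    size  : ℕ
    arity : Fin size → ℕ
    arity-pos : ∀ i → 1 ≤ arity i
open Sig public

-- The fluted 1-literals are ±p(x₁) with p unary; a maximal consistent set of them is
-- determined by which unary p occur positively.  The fluted 2-literals are ±p(x₂)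
-- (p unary) and ±p(x₁,x₂) (p binary); a maximal consistent set is determined by which
-- such p occur positively.  We encode a type as a vector of truth values indexed by
-- ALL predicates, with the entries of predicates that have no literal of that kind
-- fixed to false (canonical encoding, so distinct types = distinct vectors).
Assignment : Sig → Set
Assignment σ = Vec Bool (size σ)

Is1Type : (σ : Sig) → Assignment σ → Set
Is1Type σ π = ∀ i → arity σ i ≢ 1 → lookup π i ≡ false

Is2Type : (σ : Sig) → Assignment σ → Set
Is2Type σ τ = ∀ i → arity σ i ≢ 1 → arity σ i ≢ 2 → lookup τ i ≡ false

-- τ↑ : drop the literals containing x₁ (the binary ones) and rename x₂ to x₁.
_↑ : {σ : Sig} → Assignment σ → Assignment σ
_↑ {σ} τ = tabulate (λ i → if arity σ i ≡ᵇ 1 then lookup τ i else false)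

record Connector (σ : Sig) : Set where
  constructor ⟨_,_,_⟩
  field
    π   : Assignment σ
    inp : List (Assignment σ)
    out : List (Assignment σ)
open Connector public

IsConnector : (σ : Sig) → Connector σ → Set
IsConnector σ c =
  Is1Type σ (π c) × All (Is2Type σ) (inp c) × All (Is2Type σ) (out c)
  × All (λ τ → _↑ {σ} τ ≡ π c) (inp c)

GCExists : {σ : Sig} → List (Connector σ) → Set
GCExists C = ∀ {c τ} → c ∈ C → τ ∈ out c → ∃[ c' ] (c' ∈ C × τ ∈ inp c')

GCForall : {σ : Sig} → List (Connector σ) → Set
GCForall C = ∀ {c c'} → c ∈ C → c' ∈ C → ∃[ τ ] (τ ∈ out c × τ ∈ inp c')

GloballyCoherent : {σ : Sig} → List (Connector σ) → Set
GloballyCoherent C = GCExists C × GCForall C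

-- Fix a globally coherent list C.  For every fluted 2-type τ that occurs as
-- an output of some member of C, (GC∃) provides a member of C having τ as an input;
-- let D collect one such witness per τ.  Then:
--   * D ⊆ C, and D has at most one element per 2-type, hence |D| ≤ 2^|σ|, since
--     2-types are encoded as Boolean vectors of length |σ|;
--   * (GC∃) holds for D: an output τ of a member of D is an output of a member of C,
--     so its chosen witness lies in D;
--   * (GC∀) is inherited by every subset, so it holds for D;
--   * D is non-empty: (GC∀) applied to a member c of C and itself gives an output
--     of c, whose witness lies in D.
module Submission where

open import Defs
open import Data.Nat using (ℕ; _≤_; _^_; zero; suc; _+_; z≤n; s≤s)
open import Data.Nat.Properties using (m≤n⇒m≤1+n; +-identityʳ)
open import Data.Bool using (Bool; true; false)
import Data.Bool.Properties as Bool
open import Data.Vec using (Vec; []; _∷_)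
import Data.Vec.Properties as Vec
open import Data.List using (List; []; _∷_; length; _++_; map)
open import Data.List.Properties using (length-++; length-map)
open import Data.List.Relation.Unary.All using (All)
open import Data.List.Relation.Unary.Any using (Any; here; there; any?)
open import Data.List.Relation.Binary.Subset.Propositional using (_⊆_)
open import Data.List.Membership.Propositional using (_∈_; find; lose)
open import Data.List.Membership.Propositional.Properties using (∈-++⁺ˡ; ∈-++⁺ʳ; ∈-map⁺)
import Data.List.Membership.DecPropositional as DecMembership
open import Data.Product using (_×_; ∃-syntax; _,_)
open import Data.Empty using (⊥-elim)
open import Relation.Nullary using (yes; no)
open import Relation.Unary using (Decidable)
open import Relation.Binary.PropositionalEquality using (_≢_; _≡_; refl; cong₂; sym; module ≡-Reasoning)

member⇒nonEmpty : {A : Set} {x : A} {xs : List A} → x ∈ xs → xs ≢ []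
member⇒nonEmpty (here _)  ()
member⇒nonEmpty (there _) ()

module _ {A T : Set} (C : List A) {P : T → Set} (P? : Decidable P) (W : T → A → Set)
         (witness : ∀ {t} → P t → ∃[ c ] (c ∈ C × W t c)) where

  Covers : List A → List T → Set
  Covers D ts = ∀ {t} → t ∈ ts → P t → ∃[ c ] (c ∈ D × W t c)

  selectWitnesses : (ts : List T) → ∃[ D ] (D ⊆ C × length D ≤ length ts × Covers D ts)
  selectWitnesses [] = [] , (λ ()) , z≤n , (λ ())
  selectWitnesses (t ∷ ts) with selectWitnesses ts | P? t
  ... | D , D⊆C , |D|≤ , covers | no ¬Pt = D , D⊆C , m≤n⇒m≤1+n |D|≤ , covers′
    where
    covers′ : Covers D (t ∷ ts)
    covers′ (here refl) Pt = ⊥-elim (¬Pt Pt)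
    covers′ (there t∈ts) Pt = covers t∈ts Pt
  ... | D , D⊆C , |D|≤ , covers | yes Pt with witness Pt
  ...   | c , c∈C , Wtc = c ∷ D , c∷D⊆C , s≤s |D|≤ , covers′
    where
    c∷D⊆C : c ∷ D ⊆ C
    c∷D⊆C (here refl) = c∈C
    c∷D⊆C (there d∈D) = D⊆C d∈D

    covers′ : Covers (c ∷ D) (t ∷ ts)
    covers′ (here refl) _ = c , here refl , Wtc
    covers′ (there t∈ts) Pt′ with covers t∈ts Pt′
    ... | c′ , c′∈D , W = c′ , there c′∈D , W

allVecs : (n : ℕ) → List (Vec Bool n)
allVecs zero    = [] ∷ []
allVecs (suc n) = map (true ∷_) (allVecs n) ++ map (false ∷_) (allVecs n)

allVecs-complete : ∀ {n} (v : Vec Bool n) → v ∈ allVecs n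
allVecs-complete []                 = here refl
allVecs-complete {suc n} (true ∷ v)  = ∈-++⁺ˡ (∈-map⁺ (true ∷_) (allVecs-complete v))
allVecs-complete {suc n} (false ∷ v) =
  ∈-++⁺ʳ (map (true ∷_) (allVecs n)) (∈-map⁺ (false ∷_) (allVecs-complete v))

allVecs-length : ∀ n → length (allVecs n) ≡ 2 ^ n
allVecs-length zero    = refl
allVecs-length (suc n) = begin
  length (map (true ∷_) vs ++ map (false ∷_) vs)         ≡⟨ length-++ (map (true ∷_) vs) ⟩
  length (map (true ∷_) vs) + length (map (false ∷_) vs) ≡⟨ cong₂ _+_ (length-map (true ∷_) vs)
                                                                       (length-map (false ∷_) vs) ⟩
  length vs + length vs                                   ≡⟨ cong₂ _+_ (allVecs-length n) (allVecs-length n) ⟩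
  2 ^ n + 2 ^ n                                           ≡⟨ cong₂ _+_ refl (sym (+-identityʳ (2 ^ n))) ⟩
  2 ^ suc n                                               ∎
  where
  open ≡-Reasoning
  vs = allVecs n

module _ {σ : Sig} where

  IsOutputOf : List (Connector σ) → Assignment σ → Set
  IsOutputOf C τ = Any (λ c → τ ∈ out c) C

  isOutputOf? : (C : List (Connector σ)) → Decidable (IsOutputOf C)
  isOutputOf? C τ = any? (λ c → τ ∈? out c) C
    where open DecMembership (Vec.≡-dec Bool._≟_) using (_∈?_)

  gcExists-witness : {C : List (Connector σ)} → GCExists C →
                     ∀ {τ} → IsOutputOf C τ → ∃[ c ] (c ∈ C × τ ∈ inp c)
  gcExists-witness gcExists τ-out with find τ-out
  ... | c , c∈C , τ∈out = gcExists c∈C τ∈out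

  gcForall-⊆ : {C D : List (Connector σ)} → D ⊆ C → GCForall C → GCForall D
  gcForall-⊆ D⊆C gcForall c∈D c′∈D = gcForall (D⊆C c∈D) (D⊆C c′∈D)

  gcExists-⊆ : {C D : List (Connector σ)} → D ⊆ C →
               (∀ {τ} → IsOutputOf C τ → ∃[ c ] (c ∈ D × τ ∈ inp c)) → GCExists D
  gcExists-⊆ D⊆C covers c∈D τ∈out = covers (lose (D⊆C c∈D) τ∈out)

lemma4 : (σ : Sig) (C : List (Connector σ)) → All (IsConnector σ) C →
    C ≢ [] → GloballyCoherent C →
    ∃[ D ] (D ⊆ C × D ≢ [] × GloballyCoherent D × length D ≤ 2 ^ size σ)
lemma4 σ [] _ C≢[] _ = ⊥-elim (C≢[] refl)
lemma4 σ C@(c ∷ _) _ _ (gcExists , gcForall)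
  with selectWitnesses C (isOutputOf? C) (λ τ c → τ ∈ inp c) (gcExists-witness gcExists)
                       (allVecs (size σ))
... | D , D⊆C , |D|≤ , covers =
  D , D⊆C , D≢[] , (gcExists-⊆ D⊆C coversAll , gcForall-⊆ D⊆C gcForall) , |D|≤2^|σ|
  where
  coversAll : ∀ {τ} → IsOutputOf C τ → ∃[ c ] (c ∈ D × τ ∈ inp c)
  coversAll = covers (allVecs-complete _)

  |D|≤2^|σ| : length D ≤ 2 ^ size σ
  |D|≤2^|σ| rewrite sym (allVecs-length (size σ)) = |D|≤

  -- c has an output by (GC∀) for the pair (c, c); its witness lies in D.
  D≢[] : D ≢ []
  D≢[] with gcForall (here refl) (here refl)
  ... | τ , τ∈out , _ with coversAll (here τ∈out)
  ...   | _ , c′∈D , _ = member⇒nonEmpty c′∈D
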